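{- For every integer $k\ge 6$, $\Xi(k)\le 3k-9$.
   Context: All graphs are finite, simple and undirected. For a graph $G=(V,E)$ and $x\in V$, $N[x]=\{x\}\cup\{y: xy\in E\}$. A set $C\subseteq V$ is identifying if $N[x]\cap C\ne\emptyset$ for every $x\in V$ and $N[x]\cap C\neq N[y]\cap C$ for all distinct $x,y\in V$. For $n\ge k\ge1$, $\mathfrak{Gr}(n,k)$ is the set of graphs on $n$ vertices in which every $k$-element subset of vertices is identifying, and $\Xi(k)=\max\{n\ge k:\mathfrak{Gr}(n,k)\ne\emptyset\}$. -}

module Defs where

open import Data.Nat using (ℕ; _≤_)
open import Data.Bool using (Bool; true; false)
open import Data.Fin using (Fin)
open import Data.Fin.Subset using (Subset; _∈_; ∣_∣)
open import Data.Product using (_×_)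
open import Data.Sum using (_⊎_)
open import Relation.Binary.PropositionalEquality using (_≡_; _≢_)
open import Relation.Nullary using (¬_)
open import Function.Bundles using (_⇔_)

record Graph (n : ℕ) : Set where
  field
    adj    : Fin n → Fin n → Bool
    sym    : ∀ x y → adj x y ≡ adj y x
    irrefl : ∀ x → adj x x ≡ false
open Graph public

_∈N[_]_ : ∀ {n} → Fin n → Graph n → Fin n → Set
y ∈N[ G ] x = y ≡ x ⊎ adj G x y ≡ true

Identifying : ∀ {n} → Graph n → Subset n → Set
Identifying {n} G C =
  (∀ (x : Fin n) → ¬ (∀ c → c ∈ C → ¬ (c ∈N[ G ] x)))
  × (∀ (x y : Fin n) → x ≢ y →
       ¬ (∀ c → c ∈ C → ((c ∈N[ G ] x) ⇔ (c ∈N[ G ] y))))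

-- G ∈ 𝔊𝔯(n,k): every k-element subset of the vertices is identifying
-- (membership in 𝔊𝔯(n,k) also requires n ≥ k, carried separately).
EveryKSetIdentifying : ∀ {n} → Graph n → ℕ → Set
EveryKSetIdentifying {n} G k = ∀ (C : Subset n) → ∣ C ∣ ≡ k → Identifying G C

-- Put L = n + 1 − k. A k-set avoiding N[x], or missing N[x] Δ N[y], exists as soon as |N[x]| < L,
-- or |N[x] Δ N[y]| < L; so the closed neighbourhoods together with the empty set form n + 1 binary
-- words of length n at pairwise distance at least L. Plotkin's double count of the ordered pairs
-- of words separated by each coordinate gives 2L ≤ n + 1, i.e. n < 2k, which is below 3k − 9
-- except for (k, n) ∈ {(6, 10), (6, 11), (7, 13)}. For n = 11 and n = 13 the bound is attained,
-- so |N[x]| = |N[x] Δ N[y]| = L throughout: the degree sum 11 · 6 contradicts the handshake lemma,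
-- resp. |N[x] Δ N[y]| = |N[x]| + |N[y]| − 2 |N[x] ∩ N[y]| would be even. For n = 10, appending the
-- parity of |N[x]| to every word raises the minimum distance to 6 and makes Plotkin's bound for
-- odd length tight. This forces six vertices with |N[x]| = 5 and four with |N[x]| = 6, with all
-- intersections |N[x] ∩ N[y]| determined, and then two of the former share three closed
-- neighbours where they may share only two.

module Submission where

open import Defs
open import Data.Nat using (ℕ; zero; suc; pred; _+_; _*_; _∸_; _≤_; _<_; z≤n; s≤s; s≤s⁻¹; >-nonZero)
open import Data.Nat using () renaming (_≟_ to _≟ℕ_)
open import Data.Nat.Properties hiding (_≟_; suc-injective)
open import Data.Nat.Tactic.RingSolver using (solve-∀)
open import Data.Bool using (Bool; true; false; not; _∧_; _∨_; _xor_; if_then_else_)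
open import Data.Bool.Properties
  using (xor-identityʳ; xor-same; not-distribˡ-xor; ∧-comm; ∧-idem; ∧-conicalˡ; ∧-conicalʳ)
open import Data.Fin using (Fin; zero; suc; _≟_)
open import Data.Fin.Properties using (suc-injective)
open import Data.Fin.Subset using (Subset; _∈_; ∣_∣)
open import Data.Vec using ([]; _∷_; here; there)
open import Data.Product using (∃; _×_; _,_; proj₁; proj₂)
open import Data.Sum using (_⊎_; inj₁; inj₂; [_,_]′)
open import Data.Empty using (⊥)
open import Function using (_∘_; id; _⇔_; mk⇔; Equivalence)
open import Relation.Nullary using (¬_; yes; no; does; contradiction)
open import Relation.Binary.PropositionalEquality as ≡ hiding (sym)
open import Relation.Binary.Definitions using (tri<; tri≈; tri>)
open import Algebra.Properties.Semiring.Sum +-*-semiring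
  using (sum; sum-syntax; sum-cong-≗; ∑-distrib-+; ∑-comm; *-distribˡ-sum; *-distribʳ-sum)

-- Finite sums and counting

sum-const : ∀ n c → ∑[ i < n ] c ≡ n * c
sum-const zero    c = refl
sum-const (suc n) c = cong (c +_) (sum-const n c)

sum-mono-≤ : ∀ {n} {f g : Fin n → ℕ} → (∀ i → f i ≤ g i) → sum f ≤ sum g
sum-mono-≤ {zero}  f≤g = z≤n
sum-mono-≤ {suc n} f≤g = +-mono-≤ (f≤g zero) (sum-mono-≤ (f≤g ∘ suc))

sum-mono-< : ∀ {n} {f g : Fin n → ℕ} → (∀ i → f i ≤ g i) → ∀ i → f i < g i → sum f < sum g
sum-mono-< f≤g zero    fi<gi = +-mono-<-≤ fi<gi (sum-mono-≤ (f≤g ∘ suc))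
sum-mono-< f≤g (suc i) fi<gi = +-mono-≤-< (f≤g zero) (sum-mono-< (f≤g ∘ suc) i fi<gi)

pointwise-≤∧sum-≥⇒≡ : ∀ {n} {f g : Fin n → ℕ} → (∀ i → f i ≤ g i) → sum g ≤ sum f → ∀ i → f i ≡ g i
pointwise-≤∧sum-≥⇒≡ f≤g Σg≤Σf i with m≤n⇒m<n∨m≡n (f≤g i)
... | inj₁ fi<gi = contradiction Σg≤Σf (<⇒≱ (sum-mono-< f≤g i fi<gi))
... | inj₂ fi≡gi = fi≡gi

bit : Bool → ℕ
bit true  = 1
bit false = 0

count : ∀ {n} → (Fin n → Bool) → ℕ
count P = ∑[ i < _ ] bit (P i)

bit-≤-1 : ∀ b → bit b ≤ 1
bit-≤-1 true  = ≤-refl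
bit-≤-1 false = z≤n

count-≤ : ∀ {n} (P : Fin n → Bool) → count P ≤ n
count-≤ {n} P = ≤-trans (sum-mono-≤ (bit-≤-1 ∘ P)) (≤-reflexive (trans (sum-const n 1) (*-identityʳ n)))

bit-mono : ∀ {b c} → (b ≡ true → c ≡ true) → bit b ≤ bit c
bit-mono {false} _   = z≤n
bit-mono {true}  b⇒c rewrite b⇒c refl = ≤-refl

bit-injective : ∀ {b c} → bit b ≡ bit c → b ≡ c
bit-injective {true}  {true}  _ = refl
bit-injective {false} {false} _ = refl

count-⊆∧≥⇒⊇ : ∀ {n} {P Q : Fin n → Bool} → (∀ i → P i ≡ true → Q i ≡ true) → count Q ≤ count P →
              ∀ i → Q i ≡ true → P i ≡ true
count-⊆∧≥⇒⊇ P⊆Q #Q≤#P i Qi =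
  trans (bit-injective (pointwise-≤∧sum-≥⇒≡ (λ j → bit-mono (P⊆Q j)) #Q≤#P i)) Qi

count-+-complement : ∀ {n} (P : Fin n → Bool) → count P + count (not ∘ P) ≡ n
count-+-complement {n} P = begin
  count P + count (not ∘ P)        ≡⟨ ∑-distrib-+ (bit ∘ P) (bit ∘ not ∘ P) ⟨
  ∑[ i < n ] (bit (P i) + bit (not (P i))) ≡⟨ sum-cong-≗ (λ i → bit-+-not (P i)) ⟩
  ∑[ i < n ] 1                     ≡⟨ sum-const n 1 ⟩
  n * 1                            ≡⟨ *-identityʳ n ⟩
  n                                ∎
  where
  open ≡-Reasoning
  bit-+-not : ∀ b → bit b + bit (not b) ≡ 1
  bit-+-not true  = refl
  bit-+-not false = refl

count-xor+∧ : ∀ {n} (u v : Fin n → Bool) →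
              count (λ i → u i xor v i) + 2 * count (λ i → u i ∧ v i) ≡ count u + count v
count-xor+∧ {n} u v = begin
  count (λ i → u i xor v i) + 2 * count (λ i → u i ∧ v i)
    ≡⟨ cong (count (λ i → u i xor v i) +_) (*-distribˡ-sum 2 (λ i → bit (u i ∧ v i))) ⟩
  count (λ i → u i xor v i) + ∑[ i < n ] (2 * bit (u i ∧ v i))
    ≡⟨ ∑-distrib-+ (λ i → bit (u i xor v i)) (λ i → 2 * bit (u i ∧ v i)) ⟨
  ∑[ i < n ] (bit (u i xor v i) + 2 * bit (u i ∧ v i))
    ≡⟨ sum-cong-≗ (λ i → bits (u i) (v i)) ⟩
  ∑[ i < n ] (bit (u i) + bit (v i))
    ≡⟨ ∑-distrib-+ (bit ∘ u) (bit ∘ v) ⟩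
  count u + count v ∎
  where
  open ≡-Reasoning
  bits : ∀ a b → bit (a xor b) + 2 * bit (a ∧ b) ≡ bit a + bit b
  bits true  true  = refl
  bits true  false = refl
  bits false true  = refl
  bits false false = refl

count-∧+∧-not : ∀ {n} (P Q : Fin n → Bool) →
                count (λ i → P i ∧ Q i) + count (λ i → P i ∧ not (Q i)) ≡ count P
count-∧+∧-not P Q = trans (≡.sym (∑-distrib-+ (λ i → bit (P i ∧ Q i)) (λ i → bit (P i ∧ not (Q i)))))
                          (sum-cong-≗ (λ i → bits (P i) (Q i)))
  where
  bits : ∀ a b → bit (a ∧ b) + bit (a ∧ not b) ≡ bit a
  bits true  true  = refl
  bits true  false = refl
  bits false _     = refl

_==_ : ∀ {n} → Fin n → Fin n → Bool
i == j = does (i ≟ j)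

count-== : ∀ {n} (i : Fin n) → count (i ==_) ≡ 1
count-== {suc n} zero    = cong suc (trans (sum-cong-≗ {n} (λ _ → refl)) (trans (sum-const n 0) (*-zeroʳ n)))
count-== {suc n} (suc i) = trans (sum-cong-≗ suc==suc) (count-== i)
  where
  suc==suc : ∀ j → bit (suc i == suc j) ≡ bit (i == j)
  suc==suc j with i ≟ j
  ... | yes _ = refl
  ... | no  _ = refl

not-==⇒≢ : ∀ {n} {i j : Fin n} → not (i == j) ≡ true → i ≢ j
not-==⇒≢ {i = i} {j} i≠j i≡j with i ≟ j
not-==⇒≢ () _ | yes _
... | no i≢j = i≢j i≡j

≢⇒not-== : ∀ {n} {i j : Fin n} → i ≢ j → not (i == j) ≡ true
≢⇒not-== {i = i} {j} i≢j with i ≟ j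
... | yes i≡j = contradiction i≡j i≢j
... | no  _   = refl

count-remove : ∀ {n} (P : Fin n → Bool) {i} → P i ≡ true → count P ≡ suc (count (λ j → P j ∧ not (i == j)))
count-remove {n} P {i} Pi = begin
  count P                                      ≡⟨ sum-cong-≗ split ⟩
  ∑[ j < n ] (bit (P′ j) + bit (i == j))       ≡⟨ ∑-distrib-+ (bit ∘ P′) (λ j → bit (i == j)) ⟩
  count P′ + count (i ==_)                     ≡⟨ cong (count P′ +_) (count-== i) ⟩
  count P′ + 1                                 ≡⟨ +-comm _ 1 ⟩
  suc (count P′)                               ∎
  where
  open ≡-Reasoning
  P′ : Fin n → Bool
  P′ j = P j ∧ not (i == j)
  split : ∀ j → bit (P j) ≡ bit (P j ∧ not (i == j)) + bit (i == j)
  split j with i ≟ j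
  ... | yes refl rewrite Pi = refl
  ... | no  _ with P j
  ...   | true  = refl
  ...   | false = refl

count-pos⇒∃ : ∀ {n} (P : Fin n → Bool) → 0 < count P → ∃ λ i → P i ≡ true
count-pos⇒∃ {suc n} P pos with P zero in P0
... | true  = zero , P0
... | false = let i , Pi = count-pos⇒∃ (P ∘ suc) pos in suc i , Pi

TwoDistinct : ∀ {n} → (Fin n → Bool) → Set
TwoDistinct P = ∃ λ i → ∃ λ j → i ≢ j × P i ≡ true × P j ≡ true

count≥2⇒twoDistinct : ∀ {n} (P : Fin n → Bool) → 2 ≤ count P → TwoDistinct P
count≥2⇒twoDistinct P 2≤#P with count-pos⇒∃ P (≤-trans (s≤s z≤n) 2≤#P)
... | i , Pi with count-pos⇒∃ (λ j → P j ∧ not (i == j)) (s≤s⁻¹ (≤-trans 2≤#P (≤-reflexive (count-remove P Pi))))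
... | j , Pj∧j≠i = i , j , not-==⇒≢ (∧-conicalʳ (P j) _ Pj∧j≠i) , Pi , ∧-conicalˡ _ (not (i == j)) Pj∧j≠i

distinct³⇒count≥3 : ∀ {n} (P : Fin n → Bool) {a b c} → a ≢ b → a ≢ c → b ≢ c →
                    P a ≡ true → P b ≡ true → P c ≡ true → 3 ≤ count P
distinct³⇒count≥3 P {a} {b} {c} a≢b a≢c b≢c Pa Pb Pc =
  subst (3 ≤_) (≡.sym (count-remove P Pa))
    (s≤s (subst (2 ≤_) (≡.sym (count-remove P₁ P₁b))
      (s≤s (subst (1 ≤_) (≡.sym (count-remove P₂ P₂c)) (s≤s z≤n)))))
  where
  P₁ P₂ : _ → Bool
  P₁ j = P j ∧ not (a == j)
  P₂ j = P₁ j ∧ not (b == j)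
  P₁b : P₁ b ≡ true
  P₁b = cong₂ _∧_ Pb (≢⇒not-== a≢b)
  P₂c : P₂ c ≡ true
  P₂c = cong₂ _∧_ (cong₂ _∧_ Pc (≢⇒not-== a≢c)) (≢⇒not-== b≢c)

choose : ∀ {n} → ℕ → (Fin n → Bool) → Subset n
choose {zero}  _       _ = []
choose {suc n} zero    P = false ∷ choose zero (P ∘ suc)
choose {suc n} (suc k) P =
  if P zero then true ∷ choose k (P ∘ suc) else false ∷ choose (suc k) (P ∘ suc)

∣choose∣≡ : ∀ {n} k (P : Fin n → Bool) → k ≤ count P → ∣ choose k P ∣ ≡ k
∣choose∣≡ {zero}  zero    P _ = refl
∣choose∣≡ {suc n} zero    P _ = ∣choose∣≡ zero (P ∘ suc) z≤n
∣choose∣≡ {suc n} (suc k) P k<#P with P zero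
... | true  = cong suc (∣choose∣≡ k (P ∘ suc) (s≤s⁻¹ k<#P))
... | false = ∣choose∣≡ (suc k) (P ∘ suc) k<#P

choose-⊆ : ∀ {n} k (P : Fin n → Bool) {x} → x ∈ choose k P → P x ≡ true
choose-⊆ {suc n} zero    P {suc x} (there x∈C) = choose-⊆ zero (P ∘ suc) x∈C
choose-⊆ {suc n} (suc k) P x∈C with P zero in P0
choose-⊆ {suc n} (suc k) P {zero}  here        | true  = P0
choose-⊆ {suc n} (suc k) P {suc x} (there x∈C) | true  = choose-⊆ k (P ∘ suc) x∈C
choose-⊆ {suc n} (suc k) P {suc x} (there x∈C) | false = choose-⊆ (suc k) (P ∘ suc) x∈C

-- Binary codes: a code of N words of length m is a map Fin N → Fin m → Bool

distance : ∀ {m} → (Fin m → Bool) → (Fin m → Bool) → ℕ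
distance u v = count (λ z → u z xor v z)

MinDistance : ∀ {N m} → ℕ → (Fin N → Fin m → Bool) → Set
MinDistance L c = ∀ i j → i ≢ j → L ≤ distance (c i) (c j)

totalDistance : ∀ {N m} → (Fin N → Fin m → Bool) → ℕ
totalDistance {N} c = ∑[ i < N ] ∑[ j < N ] distance (c i) (c j)

separatedPairs : ∀ {N} → (Fin N → Bool) → ℕ
separatedPairs {N} u = ∑[ i < N ] ∑[ j < N ] bit (u i xor u j)

totalDistance≡∑separatedPairs : ∀ {N m} (c : Fin N → Fin m → Bool) →
                                totalDistance c ≡ ∑[ z < m ] separatedPairs (λ i → c i z)
totalDistance≡∑separatedPairs {N} {m} c = begin
  ∑[ i < N ] ∑[ j < N ] ∑[ z < m ] bit (c i z xor c j z)
    ≡⟨ sum-cong-≗ (λ i → ∑-comm (λ j z → bit (c i z xor c j z))) ⟩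
  ∑[ i < N ] ∑[ z < m ] ∑[ j < N ] bit (c i z xor c j z)
    ≡⟨ ∑-comm (λ i z → ∑[ j < N ] bit (c i z xor c j z)) ⟩
  ∑[ z < m ] separatedPairs (λ i → c i z) ∎
  where open ≡-Reasoning

count-const : ∀ {N} b → count {N} (λ _ → b) ≡ N * bit b
count-const {N} b = sum-const N (bit b)

count-const∧ : ∀ {N} b (u : Fin N → Bool) → count (λ j → b ∧ u j) ≡ bit b * count u
count-const∧ true  u = ≡.sym (+-identityʳ (count u))
count-const∧ {N} false u = trans (count-const {N} false) (*-zeroʳ N)

separatedPairs-identity : ∀ {N} (u : Fin N → Bool) →
                          separatedPairs u + 2 * (count u * count u) ≡ 2 * (N * count u)
separatedPairs-identity {N} u = begin
  separatedPairs u + 2 * (s * s)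
    ≡⟨ cong (λ t → separatedPairs u + 2 * t) (*-distribʳ-sum s (bit ∘ u)) ⟩
  separatedPairs u + 2 * ∑[ i < N ] (bit (u i) * s)
    ≡⟨ cong (separatedPairs u +_) (*-distribˡ-sum 2 (λ i → bit (u i) * s)) ⟩
  separatedPairs u + ∑[ i < N ] (2 * (bit (u i) * s))
    ≡⟨ ∑-distrib-+ (λ i → ∑[ j < N ] bit (u i xor u j)) (λ i → 2 * (bit (u i) * s)) ⟨
  ∑[ i < N ] (∑[ j < N ] bit (u i xor u j) + 2 * (bit (u i) * s))
    ≡⟨ sum-cong-≗ row ⟩
  ∑[ i < N ] (N * bit (u i) + s)
    ≡⟨ ∑-distrib-+ (λ i → N * bit (u i)) (λ _ → s) ⟩
  ∑[ i < N ] (N * bit (u i)) + ∑[ i < N ] s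
    ≡⟨ cong₂ _+_ (≡.sym (*-distribˡ-sum N (bit ∘ u))) (sum-const N s) ⟩
  N * s + N * s
    ≡⟨ cong (N * s +_) (+-identityʳ (N * s)) ⟨
  2 * (N * s) ∎
  where
  open ≡-Reasoning
  s = count u
  row : ∀ i → ∑[ j < N ] bit (u i xor u j) + 2 * (bit (u i) * s) ≡ N * bit (u i) + s
  row i = begin
    count (λ j → u i xor u j) + 2 * (bit (u i) * s)
      ≡⟨ cong (λ t → count (λ j → u i xor u j) + 2 * t) (count-const∧ (u i) u) ⟨
    count (λ j → u i xor u j) + 2 * count (λ j → u i ∧ u j)
      ≡⟨ count-xor+∧ (λ _ → u i) u ⟩
    count {N} (λ _ → u i) + s
      ≡⟨ cong (_+ s) (count-const {N} (u i)) ⟩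
    N * bit (u i) + s ∎

m<n⇒2mn<m²+n² : ∀ {m n} → m < n → 2 * (m * n) < m * m + n * n
m<n⇒2mn<m²+n² {m} m<n with m≤n⇒∃[o]m+o≡n m<n
... | o , refl = subst (2 * (m * suc (m + o)) <_) (gap m o) (m<m+n _ (s≤s z≤n))
  where
  gap : ∀ m o → 2 * (m * suc (m + o)) + suc o * suc o ≡ m * m + suc (m + o) * suc (m + o)
  gap = solve-∀

m≢n⇒2mn<m²+n² : ∀ {m n} → m ≢ n → 2 * (m * n) < m * m + n * n
m≢n⇒2mn<m²+n² {m} {n} m≢n with <-cmp m n
... | tri< m<n _ _ = m<n⇒2mn<m²+n² m<n
... | tri≈ _ m≡n _ = contradiction m≡n m≢n
... | tri> _ _ n<m = subst₂ _<_ (cong (2 *_) (*-comm n m)) (+-comm (n * n) (m * m)) (m<n⇒2mn<m²+n² n<m)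

2mn≤m²+n² : ∀ m n → 2 * (m * n) ≤ m * m + n * n
2mn≤m²+n² m n with m ≟ℕ n
... | yes refl = ≤-reflexive (cong (m * m +_) (+-identityʳ (m * m)))
... | no  m≢n  = <⇒≤ (m≢n⇒2mn<m²+n² m≢n)

2*separatedPairs+[2s]²≡ : ∀ {N} (u : Fin N → Bool) →
  2 * separatedPairs u + (2 * count u) * (2 * count u) ≡ 2 * (N * (2 * count u))
2*separatedPairs+[2s]²≡ {N} u = begin
  2 * separatedPairs u + (2 * s) * (2 * s)   ≡⟨ double-sq (separatedPairs u) s ⟩
  2 * (separatedPairs u + 2 * (s * s))       ≡⟨ cong (2 *_) (separatedPairs-identity u) ⟩
  2 * (2 * (N * s))                          ≡⟨ double-mid N s ⟩
  2 * (N * (2 * s))                          ∎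
  where
  open ≡-Reasoning
  s = count u
  double-sq : ∀ X s → 2 * X + (2 * s) * (2 * s) ≡ 2 * (X + 2 * (s * s))
  double-sq = solve-∀
  double-mid : ∀ N s → 2 * (2 * (N * s)) ≡ 2 * (N * (2 * s))
  double-mid = solve-∀

2*separatedPairs≤N² : ∀ {N} (u : Fin N → Bool) → 2 * separatedPairs u ≤ N * N
2*separatedPairs≤N² {N} u = +-cancelʳ-≤ ((2 * s) * (2 * s)) _ _
  (subst (_≤ N * N + (2 * s) * (2 * s)) (≡.sym (2*separatedPairs+[2s]²≡ u)) (2mn≤m²+n² N (2 * s)))
  where s = count u

2*separatedPairs<N² : ∀ {N} (u : Fin N → Bool) → N ≢ 2 * count u → 2 * separatedPairs u < N * N
2*separatedPairs<N² {N} u N≢2s = +-cancelʳ-< ((2 * s) * (2 * s)) _ _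
  (subst (_< N * N + (2 * s) * (2 * s)) (≡.sym (2*separatedPairs+[2s]²≡ u)) (m≢n⇒2mn<m²+n² N≢2s))
  where s = count u

pointwise-≤∧sum²-≥⇒≡ : ∀ {n m} {f g : Fin n → Fin m → ℕ} → (∀ i j → f i j ≤ g i j) →
                       ∑[ i < n ] ∑[ j < m ] g i j ≤ ∑[ i < n ] ∑[ j < m ] f i j → ∀ i j → f i j ≡ g i j
pointwise-≤∧sum²-≥⇒≡ f≤g Σg≤Σf i =
  pointwise-≤∧sum-≥⇒≡ (f≤g i)
    (≤-reflexive (≡.sym (pointwise-≤∧sum-≥⇒≡ (λ i → sum-mono-≤ (f≤g i)) Σg≤Σf i)))

offDiagonal : ∀ {N} → ℕ → Fin N → Fin N → ℕ
offDiagonal L i j = if i == j then 0 else L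

∑offDiagonal : ∀ {n} L (i : Fin (suc n)) → ∑[ j < suc n ] offDiagonal L i j ≡ n * L
∑offDiagonal {n} L i = +-cancelʳ-≡ L _ _ (begin
  row + L                                          ≡⟨ cong (row +_) (*-identityʳ L) ⟨
  row + L * 1                                      ≡⟨ cong (λ t → row + L * t) (count-== i) ⟨
  row + L * count (i ==_)                          ≡⟨ cong (row +_) (*-distribˡ-sum L (λ j → bit (i == j))) ⟩
  row + ∑[ j < suc n ] (L * bit (i == j))
    ≡⟨ ∑-distrib-+ (offDiagonal L i) (λ j → L * bit (i == j)) ⟨
  ∑[ j < suc n ] (offDiagonal L i j + L * bit (i == j))     ≡⟨ sum-cong-≗ entry ⟩
  ∑[ j < suc n ] L                                          ≡⟨ sum-const (suc n) L ⟩
  L + n * L                                                 ≡⟨ +-comm L (n * L) ⟩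
  n * L + L                                                 ∎)
  where
  open ≡-Reasoning
  row = ∑[ j < suc n ] offDiagonal L i j
  entry : ∀ j → offDiagonal L i j + L * bit (i == j) ≡ L
  entry j with i ≟ j
  ... | yes _ = *-identityʳ L
  ... | no  _ = trans (cong (L +_) (*-zeroʳ L)) (+-identityʳ L)

offDiagonal-≤ : ∀ {N L} {D : Fin N → Fin N → ℕ} → (∀ i j → i ≢ j → L ≤ D i j) → ∀ i j → offDiagonal L i j ≤ D i j
offDiagonal-≤ L≤D i j with i ≟ j
... | yes _   = z≤n
... | no  i≢j = L≤D i j i≢j

column : ∀ {N m} → (Fin N → Fin m → Bool) → Fin m → Fin N → Bool
column c z i = c i z

module _ {n m L} (c : Fin (suc n) → Fin m → Bool) (minDist : MinDistance L c) where

  ∑∑offDiagonal≡ : ∑[ i < suc n ] ∑[ j < suc n ] offDiagonal L i j ≡ suc n * (n * L)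
  ∑∑offDiagonal≡ = trans (sum-cong-≗ {suc n} (∑offDiagonal L)) (sum-const (suc n) (n * L))

  totalDistance-≥ : suc n * (n * L) ≤ totalDistance c
  totalDistance-≥ = subst (_≤ totalDistance c) ∑∑offDiagonal≡
    (sum-mono-≤ (λ i → sum-mono-≤ (offDiagonal-≤ minDist i)))

  2*totalDistance≡ : 2 * totalDistance c ≡ ∑[ z < m ] (2 * separatedPairs (column c z))
  2*totalDistance≡ = trans (cong (2 *_) (totalDistance≡∑separatedPairs c))
                           (*-distribˡ-sum 2 (λ z → separatedPairs (column c z)))

  plotkin-bound : 2 * (suc n * (n * L)) ≤ m * (suc n * suc n)
  plotkin-bound = begin
    2 * (suc n * (n * L))                            ≤⟨ *-monoʳ-≤ 2 totalDistance-≥ ⟩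
    2 * totalDistance c                              ≡⟨ 2*totalDistance≡ ⟩
    ∑[ z < m ] (2 * separatedPairs (column c z))     ≤⟨ sum-mono-≤ (λ z → 2*separatedPairs≤N² (column c z)) ⟩
    ∑[ z < m ] (suc n * suc n)                       ≡⟨ sum-const m _ ⟩
    m * (suc n * suc n)                              ∎
    where open ≤-Reasoning

  plotkin-tight : (B : Fin m → ℕ) → (∀ z → 2 * separatedPairs (column c z) ≤ B z) →
                  sum B ≤ 2 * (suc n * (n * L)) →
                  (∀ i j → i ≢ j → distance (c i) (c j) ≡ L) × (∀ z → 2 * separatedPairs (column c z) ≡ B z)
  plotkin-tight B sp≤B ΣB≤ = distances≡L , pointwise-≤∧sum-≥⇒≡ sp≤B ΣB≤Σsp
    where
    ΣB≤Σsp : sum B ≤ ∑[ z < m ] (2 * separatedPairs (column c z))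
    ΣB≤Σsp = ≤-trans ΣB≤ (≤-trans (*-monoʳ-≤ 2 totalDistance-≥) (≤-reflexive 2*totalDistance≡))
    total≤ : totalDistance c ≤ ∑[ i < suc n ] ∑[ j < suc n ] offDiagonal L i j
    total≤ = subst (totalDistance c ≤_) (≡.sym ∑∑offDiagonal≡)
      (*-cancelˡ-≤ 2 (≤-trans (≤-reflexive 2*totalDistance≡) (≤-trans (sum-mono-≤ sp≤B) ΣB≤)))
    distances≡L : ∀ i j → i ≢ j → distance (c i) (c j) ≡ L
    distances≡L i j i≢j with i ≟ j | pointwise-≤∧sum²-≥⇒≡ (offDiagonal-≤ minDist) total≤ i j
    ... | yes i≡j | _    = contradiction i≡j i≢j
    ... | no  _   | L≡d  = ≡.sym L≡d

withZero : ∀ {n m} → (Fin n → Fin m → Bool) → Fin (suc n) → Fin m → Bool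
withZero a zero    _ = false
withZero a (suc x) = a x

withZero-minDistance : ∀ {n m L} {a : Fin n → Fin m → Bool} → (∀ x → L ≤ count (a x)) →
                       (∀ x y → x ≢ y → L ≤ distance (a x) (a y)) → MinDistance L (withZero a)
withZero-minDistance w d zero    zero    0≢0 = contradiction refl 0≢0
withZero-minDistance w d zero    (suc y) _   = w y
withZero-minDistance {L = L} {a} w d (suc x) zero _ =
  subst (L ≤_) (sum-cong-≗ (λ z → cong bit (≡.sym (xor-identityʳ (a x z))))) (w x)
withZero-minDistance w d (suc x) (suc y) x≢y = d x y (x≢y ∘ cong suc)

-- Closed neighbourhoods

N? : ∀ {n} → Graph n → Fin n → Fin n → Bool
N? G x c = (c == x) ∨ adj G x c

N?-⇔ : ∀ {n} (G : Graph n) {x c} → N? G x c ≡ true ⇔ c ∈N[ G ] x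
N?-⇔ G {x} {c} = mk⇔ to from
  where
  to : N? G x c ≡ true → c ∈N[ G ] x
  to N?xc with c ≟ x
  ... | yes c≡x = inj₁ c≡x
  ... | no  _   = inj₂ N?xc
  from : c ∈N[ G ] x → N? G x c ≡ true
  from c∈N with c ≟ x | c∈N
  ... | yes _   | _          = refl
  ... | no  c≢x | inj₁ c≡x   = contradiction c≡x c≢x
  ... | no  _   | inj₂ adjxc = adjxc

N?-refl : ∀ {n} (G : Graph n) x → N? G x x ≡ true
N?-refl G x = Equivalence.from (N?-⇔ G) (inj₁ refl)

N?-sym : ∀ {n} (G : Graph n) x c → N? G x c ≡ N? G c x
N?-sym G x c with c ≟ x | x ≟ c
... | yes _   | yes _   = refl
... | yes c≡x | no  x≢c = contradiction (≡.sym c≡x) x≢c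
... | no  c≢x | yes x≡c = contradiction (≡.sym x≡c) c≢x
... | no  _   | no  _   = Graph.sym G x c

deg : ∀ {n} → Graph n → Fin n → ℕ
deg G x = count (N? G x)

common : ∀ {n} → Graph n → Fin n → Fin n → ℕ
common G x y = count (λ c → N? G x c ∧ N? G y c)

distance+2*common : ∀ {n} (G : Graph n) x y → distance (N? G x) (N? G y) + 2 * common G x y ≡ deg G x + deg G y
distance+2*common G x y = count-xor+∧ (N? G x) (N? G y)

k≤count-not : ∀ {n} k (P : Fin n → Bool) → k + count P ≤ n → k ≤ count (not ∘ P)
k≤count-not k P k+#P≤n = +-cancelʳ-≤ (count P) k _
  (≤-trans k+#P≤n (≤-reflexive (trans (≡.sym (count-+-complement P)) (+-comm (count P) _))))

not-true⇒≢true : ∀ {b} → not b ≡ true → b ≢ true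
not-true⇒≢true {true} () _

not-xor⇒≡ : ∀ {a b} → not (a xor b) ≡ true → a ≡ b
not-xor⇒≡ {true}  {true}  _ = refl
not-xor⇒≡ {false} {false} _ = refl

module _ {n k} (G : Graph n) (everyKSetIdentifying : EveryKSetIdentifying G k) where

  n<k+deg : ∀ x → n < k + deg G x
  n<k+deg x = ≰⇒> λ k+deg≤n →
    let C = choose k (not ∘ N? G x)
        ∣C∣≡k = ∣choose∣≡ k (not ∘ N? G x) (k≤count-not k (N? G x) k+deg≤n)
    in proj₁ (everyKSetIdentifying C ∣C∣≡k) x λ c c∈C c∈N[x] →
         not-true⇒≢true (choose-⊆ k (not ∘ N? G x) c∈C) (Equivalence.from (N?-⇔ G) c∈N[x])

  n<k+distance : ∀ x y → x ≢ y → n < k + distance (N? G x) (N? G y)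
  n<k+distance x y x≢y = ≰⇒> λ k+d≤n →
    let Δ : Fin n → Bool
        Δ c = N? G x c xor N? G y c
        C = choose k (not ∘ Δ)
        ∣C∣≡k = ∣choose∣≡ k (not ∘ Δ) (k≤count-not k Δ k+d≤n)
    in proj₂ (everyKSetIdentifying C ∣C∣≡k) x y x≢y λ c c∈C →
         let N?xc≡N?yc = not-xor⇒≡ (choose-⊆ k (not ∘ Δ) c∈C) in
         mk⇔ (λ c∈N[x] → Equivalence.to (N?-⇔ G) (trans (≡.sym N?xc≡N?yc) (Equivalence.from (N?-⇔ G) c∈N[x])))
             (λ c∈N[y] → Equivalence.to (N?-⇔ G) (trans N?xc≡N?yc (Equivalence.from (N?-⇔ G) c∈N[y])))

  identifying⇒minDistance : MinDistance (suc n ∸ k) (withZero (N? G))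
  identifying⇒minDistance = withZero-minDistance {a = N? G}
    (λ x → m≤n+o⇒m∸n≤o (suc n) k (n<k+deg x))
    (λ x y x≢y → m≤n+o⇒m∸n≤o (suc n) k (n<k+distance x y x≢y))

module _ {n L} (c : Fin (suc n) → Fin n → Bool) (minDist : MinDistance L c) where

  private
    rearrange : ∀ n L → 2 * (suc n * (n * L)) ≡ n * (suc n * (2 * L))
    rearrange = solve-∀

  square-plotkin : 0 < n → 2 * L ≤ suc n
  square-plotkin 0<n = *-cancelˡ-≤ (suc n)
    (*-cancelˡ-≤ n {{>-nonZero 0<n}} (subst (_≤ n * (suc n * suc n)) (rearrange n L) (plotkin-bound c minDist)))

  square-plotkin-tight : 2 * L ≡ suc n → ∀ i j → i ≢ j → distance (c i) (c j) ≡ L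
  square-plotkin-tight 2L≡n+1 = proj₁ (plotkin-tight c minDist (λ _ → suc n * suc n)
    (λ z → 2*separatedPairs≤N² (column c z))
    (≤-reflexive (begin
      ∑[ z < n ] (suc n * suc n)    ≡⟨ sum-const n _ ⟩
      n * (suc n * suc n)           ≡⟨ cong (λ t → n * (suc n * t)) 2L≡n+1 ⟨
      n * (suc n * (2 * L))         ≡⟨ rearrange n L ⟨
      2 * (suc n * (n * L))         ∎)))
    where open ≡-Reasoning

handshake : ∀ {n} (a : Fin n → Fin n → Bool) → (∀ x y → a x y ≡ a y x) → (∀ x → a x x ≡ true) →
            ∃ λ q → ∑[ x < n ] count (a x) ≡ n + 2 * q
handshake {zero}  a a-sym a-refl = 0 , refl
handshake {suc n} a a-sym a-refl
  with handshake (λ x y → a (suc x) (suc y)) (λ x y → a-sym (suc x) (suc y)) (a-refl ∘ suc)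
... | q , IH = r + q , (begin
  bit (a zero zero) + r + ∑[ x < n ] (bit (a (suc x) zero) + count (a (suc x) ∘ suc))
    ≡⟨ cong₂ (λ b t → bit b + r + t) (a-refl zero)
             (∑-distrib-+ (λ x → bit (a (suc x) zero)) (λ x → count (a (suc x) ∘ suc))) ⟩
  1 + r + (∑[ x < n ] bit (a (suc x) zero) + ∑[ x < n ] count (a (suc x) ∘ suc))
    ≡⟨ cong₂ (λ s t → 1 + r + (s + t)) (sum-cong-≗ (λ x → cong bit (a-sym (suc x) zero))) IH ⟩
  1 + r + (r + (n + 2 * q))
    ≡⟨ rearrange r n q ⟩
  suc n + 2 * (r + q) ∎)
  where
  open ≡-Reasoning
  r = count (a zero ∘ suc)
  rearrange : ∀ r n q → 1 + r + (r + (n + 2 * q)) ≡ suc n + 2 * (r + q)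
  rearrange = solve-∀

∑deg≡n+2q : ∀ {n} (G : Graph n) → ∃ λ q → ∑[ x < n ] deg G x ≡ n + 2 * q
∑deg≡n+2q G = handshake (N? G) (N?-sym G) (N?-refl G)

bit-∧ : ∀ a b → bit (a ∧ b) ≡ bit a * bit b
bit-∧ true  b = ≡.sym (+-identityʳ (bit b))
bit-∧ false b = refl

∑common≡∑deg : ∀ {n} (G : Graph n) x → ∑[ y < n ] common G x y ≡ ∑[ w < n ] (bit (N? G x w) * deg G w)
∑common≡∑deg {n} G x = begin
  ∑[ y < n ] ∑[ w < n ] bit (N? G x w ∧ N? G y w)
    ≡⟨ ∑-comm (λ y w → bit (N? G x w ∧ N? G y w)) ⟩
  ∑[ w < n ] ∑[ y < n ] bit (N? G x w ∧ N? G y w)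
    ≡⟨ sum-cong-≗ (λ w → sum-cong-≗ (λ y → term w y)) ⟩
  ∑[ w < n ] ∑[ y < n ] (bit (N? G x w) * bit (N? G w y))
    ≡⟨ sum-cong-≗ (λ w → *-distribˡ-sum (bit (N? G x w)) (bit ∘ N? G w)) ⟨
  ∑[ w < n ] (bit (N? G x w) * deg G w) ∎
  where
  open ≡-Reasoning
  term : ∀ w y → bit (N? G x w ∧ N? G y w) ≡ bit (N? G x w) * bit (N? G w y)
  term w y = trans (bit-∧ (N? G x w) (N? G y w)) (cong (λ b → bit (N? G x w) * bit b) (N?-sym G y w))

-- The exceptional orders

¬minDistance-11-6 : (G : Graph 11) → ¬ MinDistance 6 (withZero (N? G))
¬minDistance-11-6 G minDist = even≢odd q 27 (+-cancelˡ-≡ 11 (2 * q) 55 (trans (≡.sym ∑deg≡11+2q) ∑deg≡66))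
  where
  q = proj₁ (∑deg≡n+2q G)
  ∑deg≡11+2q = proj₂ (∑deg≡n+2q G)
  ∑deg≡66 : ∑[ x < 11 ] deg G x ≡ 66
  ∑deg≡66 = trans (sum-cong-≗ (λ x → square-plotkin-tight (withZero (N? G)) minDist refl zero (suc x) (λ ())))
                  (sum-const 11 6)

¬minDistance-13-7 : (G : Graph 13) → ¬ MinDistance 7 (withZero (N? G))
¬minDistance-13-7 G minDist = even≢odd (common G x y) 3 (+-cancelˡ-≡ 7 (2 * common G x y) 7 (begin
  7 + 2 * common G x y                          ≡⟨ cong (_+ 2 * common G x y) (tight (suc x) (suc y) (λ ())) ⟨
  distance (N? G x) (N? G y) + 2 * common G x y ≡⟨ distance+2*common G x y ⟩
  deg G x + deg G y                             ≡⟨ cong₂ _+_ (tight zero (suc x) (λ ())) (tight zero (suc y) (λ ())) ⟩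
  14                                            ∎))
  where
  open ≡-Reasoning
  x y : Fin 13
  x = zero
  y = suc zero
  tight = square-plotkin-tight (withZero (N? G)) minDist refl

parity : ℕ → Bool
parity zero    = false
parity (suc n) = not (parity n)

parity-+ : ∀ m n → parity (m + n) ≡ parity m xor parity n
parity-+ zero    n = refl
parity-+ (suc m) n = trans (cong not (parity-+ m n)) (not-distribˡ-xor (parity m) (parity n))

parity-2* : ∀ q → parity (2 * q) ≡ false
parity-2* q = begin
  parity (q + (q + 0))        ≡⟨ parity-+ q (q + 0) ⟩
  parity q xor parity (q + 0) ≡⟨ cong (λ m → parity q xor parity m) (+-identityʳ q) ⟩
  parity q xor parity q       ≡⟨ xor-same (parity q) ⟩
  false                       ∎
  where open ≡-Reasoning

s²+30≡11s⇒s≡5∨6 : ∀ {s} → s ≤ 10 → s * s + 30 ≡ 11 * s → s ≡ 5 ⊎ s ≡ 6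
s²+30≡11s⇒s≡5∨6 {0}  _ ()
s²+30≡11s⇒s≡5∨6 {1}  _ ()
s²+30≡11s⇒s≡5∨6 {2}  _ ()
s²+30≡11s⇒s≡5∨6 {3}  _ ()
s²+30≡11s⇒s≡5∨6 {4}  _ ()
s²+30≡11s⇒s≡5∨6 {5}  _ _ = inj₁ refl
s²+30≡11s⇒s≡5∨6 {6}  _ _ = inj₂ refl
s²+30≡11s⇒s≡5∨6 {7}  _ ()
s²+30≡11s⇒s≡5∨6 {8}  _ ()
s²+30≡11s⇒s≡5∨6 {9}  _ ()
s²+30≡11s⇒s≡5∨6 {10} _ ()
s²+30≡11s⇒s≡5∨6 {suc (suc (suc (suc (suc (suc (suc (suc (suc (suc (suc s))))))))))} s≤10 _ =
  contradiction (≤-trans (m≤m+n 11 s) s≤10) (<⇒≱ (n<1+n 10))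

module TenVertices (G : Graph 10) (minDist : MinDistance 5 (withZero (N? G))) where

  odd : Fin 10 → Bool
  odd x = parity (deg G x)

  N⁺ : Fin 10 → Fin 11 → Bool
  N⁺ x zero    = odd x
  N⁺ x (suc z) = N? G x z

  #N⁺≥6 : ∀ x → 6 ≤ count (N⁺ x)
  #N⁺≥6 x = [ (λ 5<deg → ≤-trans 5<deg (m≤n+m (deg G x) (bit (odd x))))
            , (λ 5≡deg → subst (λ d → 6 ≤ bit (parity d) + d) 5≡deg ≤-refl)
            ]′ (m≤n⇒m<n∨m≡n (minDist zero (suc x) (λ ())))

  distance-N⁺≥6 : ∀ x y → x ≢ y → 6 ≤ distance (N⁺ x) (N⁺ y)
  distance-N⁺≥6 x y x≢y =
    [ (λ 5<d → ≤-trans 5<d (m≤n+m (distance (N? G x) (N? G y)) (bit (odd x xor odd y))))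
    , (λ 5≡d → subst (λ b → 6 ≤ bit b + distance (N? G x) (N? G y)) (≡.sym (parities-differ 5≡d))
                     (≤-reflexive (cong suc 5≡d)))
    ]′ (m≤n⇒m<n∨m≡n (minDist (suc x) (suc y) (x≢y ∘ suc-injective)))
    where
    parities-differ : 5 ≡ distance (N? G x) (N? G y) → odd x xor odd y ≡ true
    parities-differ 5≡d = begin
      parity (deg G x) xor parity (deg G y)                   ≡⟨ parity-+ (deg G x) (deg G y) ⟨
      parity (deg G x + deg G y)                              ≡⟨ cong parity (distance+2*common G x y) ⟨
      parity (distance (N? G x) (N? G y) + 2 * common G x y)  ≡⟨ cong (λ d → parity (d + 2 * common G x y)) 5≡d ⟨
      parity (5 + 2 * common G x y)                           ≡⟨ parity-+ 5 (2 * common G x y) ⟩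
      not (parity (2 * common G x y))                         ≡⟨ cong not (parity-2* (common G x y)) ⟩
      true                                                    ∎
      where open ≡-Reasoning

  -- Since 11 is odd, no coordinate separates more than 60 ordered pairs of the 11 words, and
  -- the 11 · 10 ordered pairs at distance at least 6 already need all of them.
  tight : (∀ i j → i ≢ j → distance (withZero N⁺ i) (withZero N⁺ j) ≡ 6)
        × (∀ z → 2 * separatedPairs (column (withZero N⁺) z) ≡ 120)
  tight = plotkin-tight (withZero N⁺) (withZero-minDistance {a = N⁺} #N⁺≥6 distance-N⁺≥6) (λ _ → 120)
    (λ z → s≤s⁻¹ (2*separatedPairs<N² (column (withZero N⁺) z) (11≢2* (count (column (withZero N⁺) z)))))
    (≤-reflexive (sum-const 11 120))
    where
    11≢2* : ∀ s → 11 ≢ 2 * s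
    11≢2* s 11≡2s = even≢odd s 5 (≡.sym 11≡2s)

  #N⁺≡6 : ∀ x → bit (odd x) + deg G x ≡ 6
  #N⁺≡6 x = proj₁ tight zero (suc x) (λ ())

  distance-N⁺≡6 : ∀ x y → x ≢ y → bit (odd x xor odd y) + distance (N? G x) (N? G y) ≡ 6
  distance-N⁺≡6 x y x≢y = proj₁ tight (suc x) (suc y) (x≢y ∘ suc-injective)

  #odd≡5∨6 : count odd ≡ 5 ⊎ count odd ≡ 6
  #odd≡5∨6 = s²+30≡11s⇒s≡5∨6 (count-≤ odd) (*-cancelˡ-≡ _ _ 4 (begin
    4 * (s * s + 30)                                         ≡⟨ rearrangeˡ s ⟩
    120 + (2 * s) * (2 * s)                                  ≡⟨ cong (_+ (2 * s) * (2 * s)) (proj₂ tight zero) ⟨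
    2 * separatedPairs (column (withZero N⁺) zero) + (2 * s) * (2 * s)
                                                             ≡⟨ 2*separatedPairs+[2s]²≡ (column (withZero N⁺) zero) ⟩
    2 * (11 * (2 * s))                                       ≡⟨ rearrangeʳ s ⟩
    4 * (11 * s)                                             ∎))
    where
    open ≡-Reasoning
    s = count odd
    rearrangeˡ : ∀ s → 4 * (s * s + 30) ≡ 120 + (2 * s) * (2 * s)
    rearrangeˡ = solve-∀
    rearrangeʳ : ∀ s → 2 * (11 * (2 * s)) ≡ 4 * (11 * s)
    rearrangeʳ = solve-∀

  #odd+∑deg≡60 : count odd + ∑[ x < 10 ] deg G x ≡ 60
  #odd+∑deg≡60 = trans (≡.sym (∑-distrib-+ (bit ∘ odd) (deg G))) (trans (sum-cong-≗ #N⁺≡6) (sum-const 10 6))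

  #odd≢5 : count odd ≢ 5
  #odd≢5 #odd≡5 = even≢odd q 22 (+-cancelˡ-≡ 15 (2 * q) 45 (begin
    15 + 2 * q                       ≡⟨ cong (_+ (10 + 2 * q)) #odd≡5 ⟨
    count odd + (10 + 2 * q)         ≡⟨ cong (count odd +_) ∑deg≡10+2q ⟨
    count odd + ∑[ x < 10 ] deg G x  ≡⟨ #odd+∑deg≡60 ⟩
    60                               ∎))
    where
    open ≡-Reasoning
    q = proj₁ (∑deg≡n+2q G)
    ∑deg≡10+2q = proj₂ (∑deg≡n+2q G)

  #odd≡6 : count odd ≡ 6
  #odd≡6 = [ (λ #odd≡5 → contradiction #odd≡5 #odd≢5) , id ]′ #odd≡5∨6

  deg-odd : ∀ x → odd x ≡ true → deg G x ≡ 5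
  deg-odd x ox = cong pred (trans (cong (λ b → bit b + deg G x) (≡.sym ox)) (#N⁺≡6 x))

  deg-even : ∀ x → odd x ≡ false → deg G x ≡ 6
  deg-even x ex = trans (cong (λ b → bit b + deg G x) (≡.sym ex)) (#N⁺≡6 x)

  odd≢even : ∀ x y → odd x ≡ true → odd y ≡ false → x ≢ y
  odd≢even x .x ox ey refl = contradiction (trans (≡.sym ox) ey) λ ()

  common≡ : ∀ x y {d p q c} → distance (N? G x) (N? G y) ≡ d → deg G x ≡ p → deg G y ≡ q →
            d + 2 * c ≡ p + q → common G x y ≡ c
  common≡ x y {d} {c = c} d≡ p≡ q≡ d+2c≡p+q = *-cancelˡ-≡ (common G x y) c 2 (+-cancelˡ-≡ d _ _ (begin
    d + 2 * common G x y                          ≡⟨ cong (_+ 2 * common G x y) d≡ ⟨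
    distance (N? G x) (N? G y) + 2 * common G x y ≡⟨ distance+2*common G x y ⟩
    deg G x + deg G y                             ≡⟨ cong₂ _+_ p≡ q≡ ⟩
    _                                             ≡⟨ d+2c≡p+q ⟨
    d + 2 * c                                     ∎))
    where open ≡-Reasoning

  common-odd-odd : ∀ {x y} → x ≢ y → odd x ≡ true → odd y ≡ true → common G x y ≡ 2
  common-odd-odd {x} {y} x≢y ox oy = common≡ x y
    (subst (λ b → bit b + distance (N? G x) (N? G y) ≡ 6) (cong₂ _xor_ ox oy) (distance-N⁺≡6 x y x≢y))
    (deg-odd x ox) (deg-odd y oy) refl

  common-odd-even : ∀ x y → odd x ≡ true → odd y ≡ false → common G x y ≡ 3
  common-odd-even x y ox ey = common≡ x y
    (cong pred (subst (λ b → bit b + distance (N? G x) (N? G y) ≡ 6) (cong₂ _xor_ ox ey)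
                      (distance-N⁺≡6 x y (odd≢even x y ox ey))))
    (deg-odd x ox) (deg-even y ey) refl

  common-self : ∀ x → common G x x ≡ deg G x
  common-self x = sum-cong-≗ (λ w → cong bit (∧-idem (N? G x w)))

  module OddVertex (f : Fin 10) (odd-f : odd f ≡ true) where

    ∑common≡27 : ∑[ y < 10 ] common G f y ≡ 27
    ∑common≡27 = +-cancelʳ-≡ 6 _ _ (begin
      ∑[ y < 10 ] common G f y + 6                         ≡⟨ cong (∑[ y < 10 ] common G f y +_) #odd≡6 ⟨
      ∑[ y < 10 ] common G f y + count odd                 ≡⟨ ∑-distrib-+ (common G f) (bit ∘ odd) ⟨
      ∑[ y < 10 ] (common G f y + bit (odd y))             ≡⟨ sum-cong-≗ row ⟩
      ∑[ y < 10 ] (3 + 3 * bit (f == y))                   ≡⟨ ∑-distrib-+ (λ _ → 3) (λ y → 3 * bit (f == y)) ⟩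
      ∑[ y < 10 ] 3 + ∑[ y < 10 ] (3 * bit (f == y))
        ≡⟨ cong₂ _+_ (sum-const 10 3) (*-distribˡ-sum 3 (bit ∘ (f ==_))) ⟨
      30 + 3 * count (f ==_)                               ≡⟨ cong (λ t → 30 + 3 * t) (count-== f) ⟩
      33                                                   ∎)
      where
      open ≡-Reasoning
      row : ∀ y → common G f y + bit (odd y) ≡ 3 + 3 * bit (f == y)
      row y with f ≟ y
      ... | yes refl = cong₂ _+_ (trans (common-self f) (deg-odd f odd-f)) (cong bit odd-f)
      ... | no  f≢y with odd y in oy
      ...   | true  = cong (_+ 1) (common-odd-odd f≢y odd-f oy)
      ...   | false = cong (_+ 0) (common-odd-even f y odd-f oy)

    ∑nbrDeg+#oddNbrs≡30 : ∑[ w < 10 ] (bit (N? G f w) * deg G w) + count (λ w → N? G f w ∧ odd w) ≡ 30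
    ∑nbrDeg+#oddNbrs≡30 = begin
      ∑[ w < 10 ] (bit (N? G f w) * deg G w) + count (λ w → N? G f w ∧ odd w)
        ≡⟨ ∑-distrib-+ (λ w → bit (N? G f w) * deg G w) (λ w → bit (N? G f w ∧ odd w)) ⟨
      ∑[ w < 10 ] (bit (N? G f w) * deg G w + bit (N? G f w ∧ odd w))
        ≡⟨ sum-cong-≗ term ⟩
      ∑[ w < 10 ] (6 * bit (N? G f w))
        ≡⟨ *-distribˡ-sum 6 (bit ∘ N? G f) ⟨
      6 * deg G f
        ≡⟨ cong (6 *_) (deg-odd f odd-f) ⟩
      30 ∎
      where
      open ≡-Reasoning
      term : ∀ w → bit (N? G f w) * deg G w + bit (N? G f w ∧ odd w) ≡ 6 * bit (N? G f w)
      term w with N? G f w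
      ... | false = refl
      ... | true  = trans (cong (_+ bit (odd w)) (+-identityʳ (deg G w)))
                          (trans (+-comm (deg G w) (bit (odd w))) (#N⁺≡6 w))

    #oddNbrs≡3 : count (λ w → N? G f w ∧ odd w) ≡ 3
    #oddNbrs≡3 = +-cancelˡ-≡ 27 _ _ (trans
      (cong (_+ count (λ w → N? G f w ∧ odd w)) (trans (≡.sym ∑common≡27) (∑common≡∑deg G f)))
      ∑nbrDeg+#oddNbrs≡30)

    #evenNbrs≡2 : count (λ w → N? G f w ∧ not (odd w)) ≡ 2
    #evenNbrs≡2 = +-cancelˡ-≡ 3 _ _ (trans (cong (_+ count (λ w → N? G f w ∧ not (odd w))) (≡.sym #oddNbrs≡3))
                                          (trans (count-∧+∧-not (N? G f) odd) (deg-odd f odd-f)))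

  open OddVertex

  common-odd-odd≱3 : ∀ {x y} → x ≢ y → odd x ≡ true → odd y ≡ true → ¬ 3 ≤ common G x y
  common-odd-odd≱3 x≢y ox oy 3≤c = <⇒≱ (n<1+n 2) (subst (3 ≤_) (common-odd-odd x≢y ox oy) 3≤c)

  evenNonNbrs : Fin 10 → Fin 10 → Bool
  evenNonNbrs f w = not (odd w) ∧ not (N? G f w)

  evenNonNbrs-elim : ∀ f w → evenNonNbrs f w ≡ true → odd w ≡ false
  evenNonNbrs-elim f w w-ok with odd w
  evenNonNbrs-elim f w ()   | true
  ... | false = refl

  #evenNonNbrs≡2 : ∀ f → odd f ≡ true → count (evenNonNbrs f) ≡ 2
  #evenNonNbrs≡2 f odd-f = +-cancelˡ-≡ 2 _ _ (begin
    2 + count (evenNonNbrs f)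
      ≡⟨ cong (_+ count (evenNonNbrs f)) (#evenNbrs≡2 f odd-f) ⟨
    count (λ w → N? G f w ∧ not (odd w)) + count (evenNonNbrs f)
      ≡⟨ cong (_+ count (evenNonNbrs f)) (sum-cong-≗ (λ w → cong bit (∧-comm (N? G f w) (not (odd w))))) ⟩
    count (λ w → not (odd w) ∧ N? G f w) + count (evenNonNbrs f)
      ≡⟨ count-∧+∧-not (not ∘ odd) (N? G f) ⟩
    count (not ∘ odd)
      ≡⟨ +-cancelˡ-≡ 6 _ _ (trans (cong (_+ count (not ∘ odd)) (≡.sym #odd≡6)) (count-+-complement odd)) ⟩
    4 ∎)
    where open ≡-Reasoning

  evenNbr-elim : ∀ f w → N? G f w ∧ not (odd w) ≡ true → N? G f w ≡ true × odd w ≡ false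
  evenNbr-elim f w ok with N? G f w | odd w
  evenNbr-elim f w () | false | _
  evenNbr-elim f w () | true  | true
  ... | true | false = refl , refl

  evenNonNbrs⊆N[g] : ∀ f g → odd f ≡ true → odd g ≡ true → f ≢ g → N? G f g ≡ true →
                     ∀ w → evenNonNbrs f w ≡ true → N? G g w ≡ true
  evenNonNbrs⊆N[g] f g odd-f odd-g f≢g f~g w w-ok = proj₁ (evenNbr-elim g w
    (count-⊆∧≥⇒⊇ evenNbrs⊆evenNonNbrs (≤-reflexive (trans (#evenNonNbrs≡2 f odd-f) (≡.sym (#evenNbrs≡2 g odd-g))))
                 w w-ok))
    where
    evenNbrs⊆evenNonNbrs : ∀ w → N? G g w ∧ not (odd w) ≡ true → evenNonNbrs f w ≡ true
    evenNbrs⊆evenNonNbrs w ok with evenNbr-elim g w ok | N? G f w in f~w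
    ... | _   , even-w | false = cong₂ _∧_ (cong not even-w) refl
    ... | g~w , even-w | true  = contradiction
      (distinct³⇒count≥3 (λ c → N? G f c ∧ N? G g c)
        f≢g (odd≢even f w odd-f even-w) (odd≢even g w odd-g even-w)
        (cong₂ _∧_ (N?-refl G f) (trans (N?-sym G g f) f~g))
        (cong₂ _∧_ f~g (N?-refl G g))
        (cong₂ _∧_ f~w g~w))
      (common-odd-odd≱3 f≢g odd-f odd-g)

  oddNbrsBut : Fin 10 → Fin 10 → Bool
  oddNbrsBut f w = (N? G f w ∧ odd w) ∧ not (f == w)

  oddNbrBut-elim : ∀ f w → oddNbrsBut f w ≡ true → N? G f w ≡ true × odd w ≡ true × f ≢ w
  oddNbrBut-elim f w ok with N? G f w | odd w | f ≟ w
  oddNbrBut-elim f w () | false | _     | _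
  oddNbrBut-elim f w () | true  | false | _
  oddNbrBut-elim f w () | true  | true  | yes _
  ... | true | true | no f≢w = refl , refl , f≢w

  #oddNbrsBut≡2 : ∀ f → odd f ≡ true → count (oddNbrsBut f) ≡ 2
  #oddNbrsBut≡2 f odd-f = cong pred (trans
    (≡.sym (count-remove (λ w → N? G f w ∧ odd w) {f} (cong₂ _∧_ (N?-refl G f) odd-f)))
    (#oddNbrs≡3 f odd-f))

  -- The two odd neighbours of an odd vertex f both contain the two even vertices outside N[f].
  noOddVertex : ∀ f → odd f ≡ true → ⊥
  noOddVertex f odd-f = go (count≥2⇒twoDistinct (oddNbrsBut f) (≤-reflexive (≡.sym (#oddNbrsBut≡2 f odd-f))))
                           (count≥2⇒twoDistinct (evenNonNbrs f) (≤-reflexive (≡.sym (#evenNonNbrs≡2 f odd-f))))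
    where
    go : TwoDistinct (oddNbrsBut f) → TwoDistinct (evenNonNbrs f) → ⊥
    go (g , h , g≢h , g-ok , h-ok) (r₁ , r₂ , r₁≢r₂ , r₁-ok , r₂-ok)
      with oddNbrBut-elim f g g-ok | oddNbrBut-elim f h h-ok
    ... | f~g , odd-g , f≢g | f~h , odd-h , f≢h = common-odd-odd≱3 g≢h odd-g odd-h
      (distinct³⇒count≥3 (λ c → N? G g c ∧ N? G h c) (f≢ r₁ r₁-ok) (f≢ r₂ r₂-ok) r₁≢r₂
        (cong₂ _∧_ (trans (N?-sym G g f) f~g) (trans (N?-sym G h f) f~h))
        (g~∧h~ r₁ r₁-ok)
        (g~∧h~ r₂ r₂-ok))
      where
      f≢ : ∀ r → evenNonNbrs f r ≡ true → f ≢ r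
      f≢ r r-ok = odd≢even f r odd-f (evenNonNbrs-elim f r r-ok)
      g~∧h~ : ∀ r → evenNonNbrs f r ≡ true → N? G g r ∧ N? G h r ≡ true
      g~∧h~ r r-ok = cong₂ _∧_ (evenNonNbrs⊆N[g] f g odd-f odd-g f≢g f~g r r-ok)
                               (evenNonNbrs⊆N[g] f h odd-f odd-h f≢h f~h r r-ok)

  impossible : ⊥
  impossible = let f , odd-f = count-pos⇒∃ odd (subst (0 <_) (≡.sym #odd≡6) (s≤s z≤n)) in noOddVertex f odd-f

data Exceptional : ℕ → ℕ → Set where
  k6n10 : Exceptional 6 10
  k6n11 : Exceptional 6 11
  k7n13 : Exceptional 7 13

m≤n≤1+m⇒n≡m∨n≡1+m : ∀ {m n} → m ≤ n → n ≤ suc m → n ≡ m ⊎ n ≡ suc m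
m≤n≤1+m⇒n≡m∨n≡1+m m≤n n≤1+m with m≤n⇒m<n∨m≡n m≤n
... | inj₁ m<n = inj₂ (≤-antisym n≤1+m m<n)
... | inj₂ m≡n = inj₁ (≡.sym m≡n)

3k∸9<n<2k⇒k≤7 : ∀ {k n} → 6 ≤ k → 3 * k ∸ 9 < n → n < 2 * k → k ≤ 7
3k∸9<n<2k⇒k≤7 {k} 6≤k 3k∸9<n n<2k = +-cancelʳ-≤ 2 k 7 (+-cancelˡ-≤ (2 * k) (k + 2) 9 (begin
  2 * k + (k + 2)        ≡⟨ rearrange k ⟩
  3 * k + 2              ≡⟨ cong (_+ 2) (m∸n+n≡m 9≤3k) ⟨
  3 * k ∸ 9 + 9 + 2      ≡⟨ shift (3 * k ∸ 9) ⟩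
  2 + (3 * k ∸ 9) + 9    ≤⟨ +-monoˡ-≤ 9 (≤-trans (s≤s 3k∸9<n) n<2k) ⟩
  2 * k + 9              ∎))
  where
  open ≤-Reasoning
  9≤3k : 9 ≤ 3 * k
  9≤3k = *-monoʳ-≤ 3 (≤-trans (s≤s (s≤s (s≤s z≤n))) 6≤k)
  rearrange : ∀ k → 2 * k + (k + 2) ≡ 3 * k + 2
  rearrange = solve-∀
  shift : ∀ a → a + 9 + 2 ≡ 2 + a + 9
  shift = solve-∀

exceptional : ∀ {k n} → 6 ≤ k → 3 * k ∸ 9 < n → n < 2 * k → Exceptional k n
exceptional 6≤k 3k∸9<n n<2k with m≤n≤1+m⇒n≡m∨n≡1+m 6≤k (3k∸9<n<2k⇒k≤7 6≤k 3k∸9<n n<2k)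
... | inj₁ refl with m≤n≤1+m⇒n≡m∨n≡1+m 3k∸9<n (s≤s⁻¹ n<2k)
...   | inj₁ refl = k6n10
...   | inj₂ refl = k6n11
exceptional 6≤k 3k∸9<n n<2k | inj₂ refl = subst (Exceptional 7) (≤-antisym 3k∸9<n (s≤s⁻¹ n<2k)) k7n13

exceptional-impossible : ∀ {k n} → Exceptional k n → (G : Graph n) → ¬ MinDistance (suc n ∸ k) (withZero (N? G))
exceptional-impossible k6n10 = TenVertices.impossible
exceptional-impossible k6n11 = ¬minDistance-11-6
exceptional-impossible k7n13 = ¬minDistance-13-7

2[m∸k]≤m⇒m≤2k : ∀ {m k} → k ≤ m → 2 * (m ∸ k) ≤ m → m ≤ 2 * k
2[m∸k]≤m⇒m≤2k {m} {k} k≤m 2[m∸k]≤m = begin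
  m             ≡⟨ m∸n+n≡m k≤m ⟨
  m ∸ k + k     ≤⟨ +-monoˡ-≤ k m∸k≤k ⟩
  k + k         ≡⟨ cong (k +_) (+-identityʳ k) ⟨
  2 * k         ∎
  where
  open ≤-Reasoning
  m∸k≤k : m ∸ k ≤ k
  m∸k≤k = +-cancelˡ-≤ (m ∸ k) (m ∸ k) k (begin
    m ∸ k + (m ∸ k)  ≡⟨ cong (m ∸ k +_) (+-identityʳ (m ∸ k)) ⟨
    2 * (m ∸ k)      ≤⟨ 2[m∸k]≤m ⟩
    m                ≡⟨ m∸n+n≡m k≤m ⟨
    m ∸ k + k        ∎)

theorem22 : ∀ (k : ℕ) → 6 ≤ k →
    ∀ (n : ℕ) → k ≤ n → (G : Graph n) → EveryKSetIdentifying G k →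
    n ≤ 3 * k ∸ 9
theorem22 k 6≤k n k≤n G identifying =
  ≮⇒≥ λ 3k∸9<n → exceptional-impossible (exceptional 6≤k 3k∸9<n n<2k) G minDist
  where
  minDist : MinDistance (suc n ∸ k) (withZero (N? G))
  minDist = identifying⇒minDistance G identifying
  n<2k : n < 2 * k
  n<2k = 2[m∸k]≤m⇒m≤2k (m≤n⇒m≤1+n k≤n)
           (square-plotkin (withZero (N? G)) minDist (≤-trans (s≤s z≤n) (≤-trans 6≤k k≤n)))
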